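{- For every $\mathrm{CAU}^-_\sigma$ term $M$ and substitution $s$, $\sigma\tau(M)=\sigma\tau(\overline{M})$ and $\sigma\tau(s)=\sigma\tau(\overline{s})$, where $\overline{\,\cdot\,}$ denotes the focused form.
   Context: The calculus $\mathrm{CAU}^-_\sigma$ uses nameless (de Bruijn) syntax: Terms $M,N ::= 1 \mid \lambda.M \mid M\,N \mid \mathsf{let}(M,N) \mid !_q M \mid q \triangleright M \mid \iota(\vartheta) \mid M[s] \mid \mathrm{er}(M)$; Trails $q ::= \mathsf{r} \mid \mathsf{t}(q,q') \mid \mathsf{ba} \mid \mathsf{bb} \mid \mathsf{ti} \mid \mathsf{lam}(q) \mid \mathsf{app}(q,q') \mid \mathsf{let}(q,q') \mid \mathsf{tr}(\zeta) \mid \mathrm{tl}(M)$; Substitutions $s,t ::= \langle\rangle \mid {\uparrow} \mid M\cdot s \mid s\circ t$. $\lambda$ binds index 1 of its body; $\mathsf{let}(M,N)$ binds index 1 in $N$; $\vartheta$ (resp. $\zeta$) is a family of nine terms (resp. trails) indexed by the constructors $\mathsf{r},\mathsf{t},\mathsf{ba},\mathsf{bb},\mathsf{ti},\mathsf{lam},\mathsf{app},\mathsf{let},\mathsf{tr}$. ${\uparrow}^n={\uparrow}\circ\cdots\circ{\uparrow}$, ${\uparrow}^0=\langle\rangle$. $\sigma$-rules: $1[\langle\rangle]\to 1$; $1[M\cdot s]\to M$; $(\lambda.M)[s]\to \lambda.(M[1\cdot(s\circ{\uparrow})])$; $(M\,N)[s]\to M[s]\,N[s]$; $(!_qM)[s]\to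 !_q(M[s])$; $\mathsf{let}(M,N)[s]\to\mathsf{let}(M[s],N[1\cdot(s\circ{\uparrow})])$; $(q\triangleright M)[s]\to q\triangleright(M[s])$; $\iota(\{M_i\})[s]\to\iota(\{M_i[s]\})$; $M[s][t]\to M[s\circ t]$; $\langle\rangle\circ s\to s$; ${\uparrow}\circ\langle\rangle\to{\uparrow}$; ${\uparrow}\circ(M\cdot s)\to s$; $(M\cdot s)\circ t\to M[t]\cdot(s\circ t)$; $(s_1\circ s_2)\circ s_3\to s_1\circ(s_2\circ s_3)$; $\mathrm{er}(1)\to 1$; $\mathrm{er}(1[{\uparrow}^n])\to 1[{\uparrow}^n]$; $\mathrm{er}(\lambda.M)\to\lambda.\mathrm{er}(M)$; $\mathrm{er}(M\,N)\to\mathrm{er}(M)\,\mathrm{er}(N)$; $\mathrm{er}(!_qM)\to !_qM$; $\mathrm{er}(\mathsf{let}(M,N))\to\mathsf{let}(\mathrm{er}(M),\mathrm{er}(N))$; $\mathrm{er}(q\triangleright M)\to\mathrm{er}(M)$; $\mathrm{er}(\iota(\{M_i\}))\to\iota(\{\mathrm{er}(M_i)\})$; $\mathrm{tl}(1)\to\mathsf{r}$; $\mathrm{tl}(1[{\uparrow}^n])\to\mathsf{r}$; $\mathrm{tl}(\lambda.M)\to\mathsf{lam}(\mathrm{tl}(M))$; $\mathrm{tl}(M\,N)\to\mathsf{app}(\mathrm{tl}(M),\mathrm{tl}(N))$; $\mathrm{tl}(!_qM)\to\mathsf{r}$; $\mathrm{tl}(\mathsf{let}(M,N))\to\mathsf{let}(\mathrm{tl}(M),\mathrm{tl}(N))$;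 $\mathrm{tl}(q\triangleright M)\to\mathsf{t}(q,\mathrm{tl}(M))$; $\mathrm{tl}(\iota(\{M_i\}))\to\mathsf{tr}(\{\mathrm{tl}(M_i)\})$. $\tau$-rules: $\mathsf{r}\triangleright M\to M$; $q\triangleright(q'\triangleright M)\to\mathsf{t}(q,q')\triangleright M$; $!_q(q'\triangleright M)\to !_{\mathsf{t}(q,q')}M$; $\lambda.(q\triangleright M)\to\mathsf{lam}(q)\triangleright\lambda.M$; $(q\triangleright M)\,N\to\mathsf{app}(q,\mathsf{r})\triangleright M\,N$; $M\,(q\triangleright N)\to\mathsf{app}(\mathsf{r},q)\triangleright M\,N$; $\mathsf{let}(q\triangleright M,N)\to\mathsf{let}(q,\mathsf{r})\triangleright\mathsf{let}(M,N)$; $\mathsf{let}(M,q\triangleright N)\to\mathsf{let}(\mathsf{r},q)\triangleright\mathsf{let}(M,N)$; $\iota(\{M_1,\dots,q\triangleright M_i,\dots,M_9\})\to\mathsf{tr}(\{\mathsf{r},\dots,q,\dots,\mathsf{r}\})\triangleright\iota(\{M_1,\dots,M_9\})$; $\mathsf{t}(q,\mathsf{r})\to q$; $\mathsf{t}(\mathsf{r},q)\to q$; $\mathsf{tr}(\{\mathsf{r},\dots,\mathsf{r}\})\to\mathsf{r}$; $\mathsf{app}(\mathsf{r},\mathsf{r})\to\mathsf{r}$; $\mathsf{lam}(\mathsf{r})\to\mathsf{r}$; $\mathsf{let}(\mathsf{r},\mathsf{r})\to\mathsf{r}$; $\mathsf{t}(\mathsf{t}(q_1,q_2),q_3)\to\mathsf{t}(q_1,\mathsf{t}(q_2,q_3))$;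 $\mathsf{t}(\mathsf{lam}(q),\mathsf{lam}(q'))\to\mathsf{lam}(\mathsf{t}(q,q'))$; $\mathsf{t}(\mathsf{lam}(q_1),\mathsf{t}(\mathsf{lam}(q_1'),q))\to\mathsf{t}(\mathsf{lam}(\mathsf{t}(q_1,q_1')),q)$; $\mathsf{t}(\mathsf{app}(q_1,q_2),\mathsf{app}(q_1',q_2'))\to\mathsf{app}(\mathsf{t}(q_1,q_1'),\mathsf{t}(q_2,q_2'))$; $\mathsf{t}(\mathsf{app}(q_1,q_2),\mathsf{t}(\mathsf{app}(q_1',q_2'),q))\to\mathsf{t}(\mathsf{app}(\mathsf{t}(q_1,q_1'),\mathsf{t}(q_2,q_2')),q)$; the same two with $\mathsf{let}$ for $\mathsf{app}$; $\mathsf{t}(\mathsf{tr}(\{q_i\}),\mathsf{tr}(\{q_i'\}))\to\mathsf{tr}(\{\mathsf{t}(q_i,q_i')\})$; $\mathsf{t}(\mathsf{tr}(\{q_i\}),\mathsf{t}(\mathsf{tr}(\{q_i'\}),q))\to\mathsf{t}(\mathsf{tr}(\{\mathsf{t}(q_i,q_i')\}),q)$. Both rule sets apply anywhere; $\sigma$ alone and $\sigma\cup\tau$ are terminating and confluent; $\sigma(X)$ and $\sigma\tau(X)$ denote the respective normal forms. Meta-level projections: $\mathrm{Er}(M)=M'$ if $\sigma\tau(M)=q\triangleright M'$, and $\mathrm{Er}(M)=\sigma\tau(M)$ otherwise; $\mathrm{Tl}(M)=q$ if $\sigma\tau(M)=q\triangleright M'$, and $\mathrm{Tl}(M)=\mathsf{r}$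 otherwise. Focused form: $\overline{M}=\mathrm{Tl}(M)\triangleright\mathrm{Er}(M)$; for a $\sigma$-normal substitution $s=N_1\cdot\ldots\cdot N_k\cdot{\uparrow}^p$, $\overline{s}=\overline{N_1}\cdot\ldots\cdot\overline{N_k}\cdot{\uparrow}^p$; for arbitrary $s$, $\overline{s}=\overline{\sigma(s)}$. -}

module Defs where

open import Data.Nat using (ℕ; zero; suc)
open import Data.Fin using (Fin)
open import Data.Vec using (Vec; lookup; map; replicate; zipWith; _[_]≔_)
open import Data.Product using (Σ; _×_; ∃)
open import Relation.Binary.PropositionalEquality using (_≡_)
open import Relation.Nullary using (¬_)
open import Relation.Binary.Construct.Closure.ReflexiveTransitive using (Star)

-- Syntax of CAU⁻_σ (nameless / de Bruijn).
-- Families ϑ, ζ indexed by the nine trail constructors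
-- r, t, ba, bb, ti, lam, app, let, tr are represented as Vec _ 9
-- (positions 0..8 in that order).

infixl 8 _[_]
infixr 6 _▷_
infixr 5 _∷ₛ_
infixr 5 _∘ₛ_

mutual
  data Term : Set where
    one  : Term                      -- the index 1
    lam  : Term → Term
    app  : Term → Term → Term
    llet : Term → Term → Term
    bang : Trail → Term → Term
    _▷_  : Trail → Term → Term
    iota : Vec Term 9 → Term
    _[_] : Term → Subst → Term
    er   : Term → Term

  data Trail : Set where
    r    : Trail
    t    : Trail → Trail → Trail
    ba   : Trail
    bb   : Trail
    ti   : Trail
    lamT : Trail → Trail
    appT : Trail → Trail → Trail
    letT : Trail → Trail → Trail
    trT  : Vec Trail 9 → Trail
    tl   : Term → Trail

  data Subst : Set where
    ⟨⟩   : Subst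
    ↑    : Subst
    _∷ₛ_ : Term → Subst → Subst
    _∘ₛ_ : Subst → Subst → Subst

↑^ : ℕ → Subst
↑^ zero = ⟨⟩
↑^ (suc zero) = ↑
↑^ (suc (suc n)) = ↑ ∘ₛ ↑^ (suc n)

data _↦σₜ_ : Term → Term → Set where
  s-id    : (one [ ⟨⟩ ]) ↦σₜ one
  s-cons  : ∀ {M s} → (one [ M ∷ₛ s ]) ↦σₜ M
  s-lam   : ∀ {M s} → (lam M [ s ]) ↦σₜ lam (M [ one ∷ₛ (s ∘ₛ ↑) ])
  s-app   : ∀ {M N s} → (app M N [ s ]) ↦σₜ app (M [ s ]) (N [ s ])
  s-bang  : ∀ {q M s} → (bang q M [ s ]) ↦σₜ bang q (M [ s ])
  s-let   : ∀ {M N s} → (llet M N [ s ]) ↦σₜ llet (M [ s ]) (N [ one ∷ₛ (s ∘ₛ ↑) ])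
  s-tr    : ∀ {q M s} → ((q ▷ M) [ s ]) ↦σₜ (q ▷ (M [ s ]))
  s-iota  : ∀ {v s} → (iota v [ s ]) ↦σₜ iota (map (_[ s ]) v)
  s-clos  : ∀ {M s u} → (M [ s ] [ u ]) ↦σₜ (M [ s ∘ₛ u ])
  e-one   : er one ↦σₜ one
  e-var   : ∀ n → er (one [ ↑^ n ]) ↦σₜ (one [ ↑^ n ])
  e-lam   : ∀ {M} → er (lam M) ↦σₜ lam (er M)
  e-app   : ∀ {M N} → er (app M N) ↦σₜ app (er M) (er N)
  e-bang  : ∀ {q M} → er (bang q M) ↦σₜ bang q M
  e-let   : ∀ {M N} → er (llet M N) ↦σₜ llet (er M) (er N)
  e-tr    : ∀ {q M} → er (q ▷ M) ↦σₜ er M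
  e-iota  : ∀ {v} → er (iota v) ↦σₜ iota (map er v)

data _↦σq_ : Trail → Trail → Set where
  l-one   : tl one ↦σq r
  l-var   : ∀ n → tl (one [ ↑^ n ]) ↦σq r
  l-lam   : ∀ {M} → tl (lam M) ↦σq lamT (tl M)
  l-app   : ∀ {M N} → tl (app M N) ↦σq appT (tl M) (tl N)
  l-bang  : ∀ {q M} → tl (bang q M) ↦σq r
  l-let   : ∀ {M N} → tl (llet M N) ↦σq letT (tl M) (tl N)
  l-tr    : ∀ {q M} → tl (q ▷ M) ↦σq t q (tl M)
  l-iota  : ∀ {v} → tl (iota v) ↦σq trT (map tl v)

data _↦σₛ_ : Subst → Subst → Set where
  c-id    : ∀ {s} → (⟨⟩ ∘ₛ s) ↦σₛ s
  c-shid  : (↑ ∘ₛ ⟨⟩) ↦σₛ ↑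
  c-shcon : ∀ {M s} → (↑ ∘ₛ (M ∷ₛ s)) ↦σₛ s
  c-cons  : ∀ {M s u} → ((M ∷ₛ s) ∘ₛ u) ↦σₛ ((M [ u ]) ∷ₛ (s ∘ₛ u))
  c-assoc : ∀ {s₁ s₂ s₃} → ((s₁ ∘ₛ s₂) ∘ₛ s₃) ↦σₛ (s₁ ∘ₛ (s₂ ∘ₛ s₃))

data _↦τₜ_ : Term → Term → Set where
  t-r     : ∀ {M} → (r ▷ M) ↦τₜ M
  t-tt    : ∀ {q q' M} → (q ▷ (q' ▷ M)) ↦τₜ (t q q' ▷ M)
  t-bang  : ∀ {q q' M} → bang q (q' ▷ M) ↦τₜ bang (t q q') M
  t-lam   : ∀ {q M} → lam (q ▷ M) ↦τₜ (lamT q ▷ lam M)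
  t-appL  : ∀ {q M N} → app (q ▷ M) N ↦τₜ (appT q r ▷ app M N)
  t-appR  : ∀ {q M N} → app M (q ▷ N) ↦τₜ (appT r q ▷ app M N)
  t-letL  : ∀ {q M N} → llet (q ▷ M) N ↦τₜ (letT q r ▷ llet M N)
  t-letR  : ∀ {q M N} → llet M (q ▷ N) ↦τₜ (letT r q ▷ llet M N)
  t-iota  : ∀ {v : Vec Term 9} {i : Fin 9} {q M} → lookup v i ≡ (q ▷ M) →
            iota v ↦τₜ (trT (replicate 9 r [ i ]≔ q) ▷ iota (v [ i ]≔ M))

data _↦τq_ : Trail → Trail → Set where
  q-tr    : ∀ {q} → t q r ↦τq q
  q-tl    : ∀ {q} → t r q ↦τq q
  q-trr   : trT (replicate 9 r) ↦τq r
  q-appr  : appT r r ↦τq r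
  q-lamr  : lamT r ↦τq r
  q-letr  : letT r r ↦τq r
  q-assoc : ∀ {q₁ q₂ q₃} → t (t q₁ q₂) q₃ ↦τq t q₁ (t q₂ q₃)
  q-lam   : ∀ {q q'} → t (lamT q) (lamT q') ↦τq lamT (t q q')
  q-lamt  : ∀ {q₁ q₁' q} → t (lamT q₁) (t (lamT q₁') q) ↦τq t (lamT (t q₁ q₁')) q
  q-app   : ∀ {q₁ q₂ q₁' q₂'} →
            t (appT q₁ q₂) (appT q₁' q₂') ↦τq appT (t q₁ q₁') (t q₂ q₂')
  q-appt  : ∀ {q₁ q₂ q₁' q₂' q} →
            t (appT q₁ q₂) (t (appT q₁' q₂') q) ↦τq t (appT (t q₁ q₁') (t q₂ q₂')) q
  q-let   : ∀ {q₁ q₂ q₁' q₂'} →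
            t (letT q₁ q₂) (letT q₁' q₂') ↦τq letT (t q₁ q₁') (t q₂ q₂')
  q-lett  : ∀ {q₁ q₂ q₁' q₂' q} →
            t (letT q₁ q₂) (t (letT q₁' q₂') q) ↦τq t (letT (t q₁ q₁') (t q₂ q₂')) q
  q-trtr  : ∀ {ζ ζ'} → t (trT ζ) (trT ζ') ↦τq trT (zipWith t ζ ζ')
  q-trtrt : ∀ {ζ ζ' q} → t (trT ζ) (t (trT ζ') q) ↦τq t (trT (zipWith t ζ ζ')) q

data Sys : Set where
  σ  : Sys
  στ : Sys

mutual
  data _⊢_⟶ₜ_ : Sys → Term → Term → Set where
    σ-root : ∀ {S M N} → M ↦σₜ N → S ⊢ M ⟶ₜ N
    τ-root : ∀ {M N} → M ↦τₜ N → στ ⊢ M ⟶ₜ N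
    c-lam  : ∀ {S M M'} → S ⊢ M ⟶ₜ M' → S ⊢ lam M ⟶ₜ lam M'
    c-appL : ∀ {S M M' N} → S ⊢ M ⟶ₜ M' → S ⊢ app M N ⟶ₜ app M' N
    c-appR : ∀ {S M N N'} → S ⊢ N ⟶ₜ N' → S ⊢ app M N ⟶ₜ app M N'
    c-letL : ∀ {S M M' N} → S ⊢ M ⟶ₜ M' → S ⊢ llet M N ⟶ₜ llet M' N
    c-letR : ∀ {S M N N'} → S ⊢ N ⟶ₜ N' → S ⊢ llet M N ⟶ₜ llet M N'
    c-bangq : ∀ {S q q' M} → S ⊢ q ⟶q q' → S ⊢ bang q M ⟶ₜ bang q' M
    c-bangM : ∀ {S q M M'} → S ⊢ M ⟶ₜ M' → S ⊢ bang q M ⟶ₜ bang q M'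
    c-trq  : ∀ {S q q' M} → S ⊢ q ⟶q q' → S ⊢ (q ▷ M) ⟶ₜ (q' ▷ M)
    c-trM  : ∀ {S q M M'} → S ⊢ M ⟶ₜ M' → S ⊢ (q ▷ M) ⟶ₜ (q ▷ M')
    c-iota : ∀ {S v} {i : Fin 9} {M'} → S ⊢ lookup v i ⟶ₜ M' →
             S ⊢ iota v ⟶ₜ iota (v [ i ]≔ M')
    c-subM : ∀ {S M M' s} → S ⊢ M ⟶ₜ M' → S ⊢ (M [ s ]) ⟶ₜ (M' [ s ])
    c-subs : ∀ {S M s s'} → S ⊢ s ⟶ₛ s' → S ⊢ (M [ s ]) ⟶ₜ (M [ s' ])
    c-er   : ∀ {S M M'} → S ⊢ M ⟶ₜ M' → S ⊢ er M ⟶ₜ er M'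

  data _⊢_⟶q_ : Sys → Trail → Trail → Set where
    σ-root : ∀ {S q q'} → q ↦σq q' → S ⊢ q ⟶q q'
    τ-root : ∀ {q q'} → q ↦τq q' → στ ⊢ q ⟶q q'
    c-tL   : ∀ {S q q' p} → S ⊢ q ⟶q q' → S ⊢ t q p ⟶q t q' p
    c-tR   : ∀ {S q p p'} → S ⊢ p ⟶q p' → S ⊢ t q p ⟶q t q p'
    c-lamT : ∀ {S q q'} → S ⊢ q ⟶q q' → S ⊢ lamT q ⟶q lamT q'
    c-appTL : ∀ {S q q' p} → S ⊢ q ⟶q q' → S ⊢ appT q p ⟶q appT q' p
    c-appTR : ∀ {S q p p'} → S ⊢ p ⟶q p' → S ⊢ appT q p ⟶q appT q p'
    c-letTL : ∀ {S q q' p} → S ⊢ q ⟶q q' → S ⊢ letT q p ⟶q letT q' p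
    c-letTR : ∀ {S q p p'} → S ⊢ p ⟶q p' → S ⊢ letT q p ⟶q letT q p'
    c-trT  : ∀ {S ζ} {i : Fin 9} {q'} → S ⊢ lookup ζ i ⟶q q' →
             S ⊢ trT ζ ⟶q trT (ζ [ i ]≔ q')
    c-tl   : ∀ {S M M'} → S ⊢ M ⟶ₜ M' → S ⊢ tl M ⟶q tl M'

  data _⊢_⟶ₛ_ : Sys → Subst → Subst → Set where
    σ-root : ∀ {S s s'} → s ↦σₛ s' → S ⊢ s ⟶ₛ s'
    c-consM : ∀ {S M M' s} → S ⊢ M ⟶ₜ M' → S ⊢ (M ∷ₛ s) ⟶ₛ (M' ∷ₛ s)
    c-conss : ∀ {S M s s'} → S ⊢ s ⟶ₛ s' → S ⊢ (M ∷ₛ s) ⟶ₛ (M ∷ₛ s')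
    c-compL : ∀ {S s s' u} → S ⊢ s ⟶ₛ s' → S ⊢ (s ∘ₛ u) ⟶ₛ (s' ∘ₛ u)
    c-compR : ∀ {S s u u'} → S ⊢ u ⟶ₛ u' → S ⊢ (s ∘ₛ u) ⟶ₛ (s ∘ₛ u')

_⊢_⟶ₜ*_ : Sys → Term → Term → Set
S ⊢ M ⟶ₜ* N = Star (S ⊢_⟶ₜ_) M N

_⊢_⟶ₛ*_ : Sys → Subst → Subst → Set
S ⊢ s ⟶ₛ* u = Star (S ⊢_⟶ₛ_) s u

Normalₜ : Sys → Term → Set
Normalₜ S M = ∀ M' → ¬ (S ⊢ M ⟶ₜ M')

Normalₛ : Sys → Subst → Set
Normalₛ S s = ∀ s' → ¬ (S ⊢ s ⟶ₛ s')

-- "N is the S-normal form of M"  (written σ(M) resp. στ(M) in the paper)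
IsNFₜ : Sys → Term → Term → Set
IsNFₜ S M N = (S ⊢ M ⟶ₜ* N) × Normalₜ S N

IsNFₛ : Sys → Subst → Subst → Set
IsNFₛ S s u = (S ⊢ s ⟶ₛ* u) × Normalₛ S u

-- Standing fact (stated in the paper's context): σ ∪ τ is confluent.
Confluentστ : Set
Confluentστ =
  (∀ {M N₁ N₂} → στ ⊢ M ⟶ₜ* N₁ → στ ⊢ M ⟶ₜ* N₂ →
     ∃ λ P → (στ ⊢ N₁ ⟶ₜ* P) × (στ ⊢ N₂ ⟶ₜ* P)) ×
  (∀ {s u₁ u₂} → στ ⊢ s ⟶ₛ* u₁ → στ ⊢ s ⟶ₛ* u₂ →
     ∃ λ w → (στ ⊢ u₁ ⟶ₛ* w) × (στ ⊢ u₂ ⟶ₛ* w))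

-- Meta-level projections, applied to the στ-normal form N = στ(M)

erPart : Term → Term
erPart (q ▷ M) = M
erPart N = N

tlPart : Term → Trail
tlPart (q ▷ M) = q
tlPart N = r

Focusₜ : Term → Term → Set
Focusₜ M Mb = Σ Term λ N → IsNFₜ στ M N × (Mb ≡ (tlPart N ▷ erPart N))

-- Focused form of a σ-normal substitution N₁ · … · N_k · ↑^p
data FocusNFₛ : Subst → Subst → Set where
  foc-shift : ∀ p → FocusNFₛ (↑^ p) (↑^ p)
  foc-cons  : ∀ {N Nb s sb} → Focusₜ N Nb → FocusNFₛ s sb →
              FocusNFₛ (N ∷ₛ s) (Nb ∷ₛ sb)

Focusₛ : Subst → Subst → Set
Focusₛ s sb = Σ Subst λ s₀ → IsNFₛ σ s s₀ × FocusNFₛ s₀ sb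

{-# OPTIONS --safe #-}
-- In a confluent system, two objects with a common reduct have the same normal
-- form. M̄ = Tl(M) ▷ Er(M) reduces to στ(M), in one step r ▷ N ⟶ N or in none;
-- so M and M̄ are joinable. Componentwise, s̄ and σ(s) meet at the substitution
-- whose components are the στ-normal forms of those of σ(s), and s ⟶σ* σ(s).
module Submission where

open import Defs
open import Data.Product using (_×_; _,_; ∃)
open import Relation.Binary.Core using (Rel)
open import Relation.Binary.PropositionalEquality using (_≡_; refl)
open import Relation.Binary.Construct.Closure.ReflexiveTransitive using (Star; ε; _◅_; _◅◅_; gmap; map)
open import Relation.Binary.Construct.Closure.Equivalence.Properties using (a—↠b⇒a↔b; a—↠b⇒b↔a)
open import Relation.Binary.Rewriting using (Confluent; conf⇒unf)
open import Relation.Nullary using (¬_)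

module _ {a ℓ} {A : Set a} {_⟶_ : Rel A ℓ} (confluent : Confluent _⟶_) where

  joinable⇒≡-normal-forms : ∀ {x y z m n} → Star _⟶_ x z → Star _⟶_ y z →
    Star _⟶_ x m → (∀ m′ → ¬ (m ⟶ m′)) →
    Star _⟶_ y n → (∀ n′ → ¬ (n ⟶ n′)) → m ≡ n
  joinable⇒≡-normal-forms x⟶*z y⟶*z x⟶*m m-normal y⟶*n n-normal =
    conf⇒unf confluent (λ (_ , step) → m-normal _ step) (λ (_ , step) → n-normal _ step)
      (a—↠b⇒b↔a x⟶*m ◅◅ a—↠b⇒a↔b x⟶*z ◅◅ a—↠b⇒b↔a y⟶*z ◅◅ a—↠b⇒a↔b y⟶*n)

mutual
  ⟶ₜ⇒στ : ∀ {S M N} → S ⊢ M ⟶ₜ N → στ ⊢ M ⟶ₜ N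
  ⟶ₜ⇒στ (σ-root step) = σ-root step
  ⟶ₜ⇒στ (τ-root step) = τ-root step
  ⟶ₜ⇒στ (c-lam step) = c-lam (⟶ₜ⇒στ step)
  ⟶ₜ⇒στ (c-appL step) = c-appL (⟶ₜ⇒στ step)
  ⟶ₜ⇒στ (c-appR step) = c-appR (⟶ₜ⇒στ step)
  ⟶ₜ⇒στ (c-letL step) = c-letL (⟶ₜ⇒στ step)
  ⟶ₜ⇒στ (c-letR step) = c-letR (⟶ₜ⇒στ step)
  ⟶ₜ⇒στ (c-bangq step) = c-bangq (⟶q⇒στ step)
  ⟶ₜ⇒στ (c-bangM step) = c-bangM (⟶ₜ⇒στ step)
  ⟶ₜ⇒στ (c-trq step) = c-trq (⟶q⇒στ step)
  ⟶ₜ⇒στ (c-trM step) = c-trM (⟶ₜ⇒στ step)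
  ⟶ₜ⇒στ (c-iota step) = c-iota (⟶ₜ⇒στ step)
  ⟶ₜ⇒στ (c-subM step) = c-subM (⟶ₜ⇒στ step)
  ⟶ₜ⇒στ (c-subs step) = c-subs (⟶ₛ⇒στ step)
  ⟶ₜ⇒στ (c-er step) = c-er (⟶ₜ⇒στ step)

  ⟶q⇒στ : ∀ {S q q′} → S ⊢ q ⟶q q′ → στ ⊢ q ⟶q q′
  ⟶q⇒στ (σ-root step) = σ-root step
  ⟶q⇒στ (τ-root step) = τ-root step
  ⟶q⇒στ (c-tL step) = c-tL (⟶q⇒στ step)
  ⟶q⇒στ (c-tR step) = c-tR (⟶q⇒στ step)
  ⟶q⇒στ (c-lamT step) = c-lamT (⟶q⇒στ step)
  ⟶q⇒στ (c-appTL step) = c-appTL (⟶q⇒στ step)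
  ⟶q⇒στ (c-appTR step) = c-appTR (⟶q⇒στ step)
  ⟶q⇒στ (c-letTL step) = c-letTL (⟶q⇒στ step)
  ⟶q⇒στ (c-letTR step) = c-letTR (⟶q⇒στ step)
  ⟶q⇒στ (c-trT step) = c-trT (⟶q⇒στ step)
  ⟶q⇒στ (c-tl step) = c-tl (⟶ₜ⇒στ step)

  ⟶ₛ⇒στ : ∀ {S s s′} → S ⊢ s ⟶ₛ s′ → στ ⊢ s ⟶ₛ s′
  ⟶ₛ⇒στ (σ-root step) = σ-root step
  ⟶ₛ⇒στ (c-consM step) = c-consM (⟶ₜ⇒στ step)
  ⟶ₛ⇒στ (c-conss step) = c-conss (⟶ₛ⇒στ step)
  ⟶ₛ⇒στ (c-compL step) = c-compL (⟶ₛ⇒στ step)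
  ⟶ₛ⇒στ (c-compR step) = c-compR (⟶ₛ⇒στ step)

∷ₛ-⟶ₛ* : ∀ {S M M′ s s′} → S ⊢ M ⟶ₜ* M′ → S ⊢ s ⟶ₛ* s′ → S ⊢ (M ∷ₛ s) ⟶ₛ* (M′ ∷ₛ s′)
∷ₛ-⟶ₛ* {M′ = M′} {s = s} M⟶*M′ s⟶*s′ =
  gmap (_∷ₛ s) c-consM M⟶*M′ ◅◅ gmap (M′ ∷ₛ_) c-conss s⟶*s′

focused⟶ₜ* : ∀ N → στ ⊢ (tlPart N ▷ erPart N) ⟶ₜ* N
focused⟶ₜ* one = τ-root t-r ◅ ε
focused⟶ₜ* (lam _) = τ-root t-r ◅ ε
focused⟶ₜ* (app _ _) = τ-root t-r ◅ ε
focused⟶ₜ* (llet _ _) = τ-root t-r ◅ ε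
focused⟶ₜ* (bang _ _) = τ-root t-r ◅ ε
focused⟶ₜ* (_ ▷ _) = ε
focused⟶ₜ* (iota _) = τ-root t-r ◅ ε
focused⟶ₜ* (_ [ _ ]) = τ-root t-r ◅ ε
focused⟶ₜ* (er _) = τ-root t-r ◅ ε

Focusₜ-joinable : ∀ {M Mb} → Focusₜ M Mb → ∃ λ P → (στ ⊢ M ⟶ₜ* P) × (στ ⊢ Mb ⟶ₜ* P)
Focusₜ-joinable (N , (M⟶*N , _) , refl) = N , M⟶*N , focused⟶ₜ* N

FocusNFₛ-joinable : ∀ {s sb} → FocusNFₛ s sb → ∃ λ w → (στ ⊢ s ⟶ₛ* w) × (στ ⊢ sb ⟶ₛ* w)
FocusNFₛ-joinable (foc-shift p) = ↑^ p , ε , ε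
FocusNFₛ-joinable (foc-cons N-focus s-focus)
  with Focusₜ-joinable N-focus | FocusNFₛ-joinable s-focus
... | P , N⟶*P , Nb⟶*P | w , s⟶*w , sb⟶*w =
  P ∷ₛ w , ∷ₛ-⟶ₛ* N⟶*P s⟶*w , ∷ₛ-⟶ₛ* Nb⟶*P sb⟶*w

Focusₛ-joinable : ∀ {s sb} → Focusₛ s sb → ∃ λ w → (στ ⊢ s ⟶ₛ* w) × (στ ⊢ sb ⟶ₛ* w)
Focusₛ-joinable (s₀ , (s⟶σ*s₀ , _) , s₀-focus) with FocusNFₛ-joinable s₀-focus
... | w , s₀⟶*w , sb⟶*w = w , map ⟶ₛ⇒στ s⟶σ*s₀ ◅◅ s₀⟶*w , sb⟶*w

lemma3 : Confluentστ →
    (∀ M Mb N N' → Focusₜ M Mb → IsNFₜ στ M N → IsNFₜ στ Mb N' → N ≡ N') ×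
    (∀ s sb u u' → Focusₛ s sb → IsNFₛ στ s u → IsNFₛ στ sb u' → u ≡ u')
lemma3 (confluentₜ , confluentₛ) = termCase , substCase
  where
  termCase : ∀ M Mb N N' → Focusₜ M Mb → IsNFₜ στ M N → IsNFₜ στ Mb N' → N ≡ N'
  termCase _ _ _ _ focus (M⟶*N , N-normal) (Mb⟶*N′ , N′-normal)
    with Focusₜ-joinable focus
  ... | _ , M⟶*P , Mb⟶*P =
    joinable⇒≡-normal-forms confluentₜ M⟶*P Mb⟶*P M⟶*N N-normal Mb⟶*N′ N′-normal

  substCase : ∀ s sb u u' → Focusₛ s sb → IsNFₛ στ s u → IsNFₛ στ sb u' → u ≡ u'
  substCase _ _ _ _ focus (s⟶*u , u-normal) (sb⟶*u′ , u′-normal)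
    with Focusₛ-joinable focus
  ... | _ , s⟶*w , sb⟶*w =
    joinable⇒≡-normal-forms confluentₛ s⟶*w sb⟶*w s⟶*u u-normal sb⟶*u′ u′-normal
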